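{- If $V$ is a closed value, then there are precisely two tight derivations for $V$, both of weight $0$: the derivation of $\vdash^0 V:\langle 1[\,]\rangle$ obtained by the rule (!) with empty index set followed by (Val), and the derivation of $\vdash^0 V:\mathbf{0}$ obtained by the rule (Zero).
   Context: Terms: values $V ::= x \mid \lambda x.M$; terms $M ::= V \mid VV \mid M\oplus M \mid \mathtt{let}\ x = M\ \mathtt{in}\ M$. Types: arrow types $\mathtt{A} ::= \mathcal{M}\to \mathtt{a}$; intersection types $\mathcal{M} ::= [q_1\cdot \mathtt{A}_1,\dots,q_n\cdot\mathtt{A}_n]$ ($n\ge 0$), a finite multiset of pairs with scale factors $q_i\in(0,1]\cap\mathbb{Q}$; type distributions $\mathtt{a} ::= \langle p_1\mathcal{M}_1,\dots,p_n\mathcal{M}_n\rangle$ ($n\ge0$, $p_i\in(0,1]$, $\sum_i p_i\le 1$). $\mathbf{0}$ is the empty type distribution. For a scalar $u$, $u\cdot[q_i\cdot\mathtt{A}_i]_i=[(uq_i)\cdot \mathtt{A}_i]_i$ and $u\cdot\langle p_i\mathcal{M}_i\rangle_i=\langle (up_i)\mathcal{M}_i\rangle_i$; $\uplus$, $\sqcup$ are multiset unions. Typing contexts map variables to intersection types (finitely many nonempty), with pointwise $\uplus$ and scaling $q\cdot\Gamma$. Judgements $\Gamma\vdash^{w} M:\tau$ ($w\in\mathbb{Q}$) are derived by: (Var) $x:\mathcal{M}\vdash^0 x:\mathcal{M}$. (Zero) $\vdash^0 M:\mathbf{0}$. (@) from $\Gamma\vdash^{w}V:[1\cdot(\mathcal{M}\to\mathtt{b})]$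 and $\Delta\vdash^{v}W:\mathcal{M}$ infer $\Gamma\uplus\Delta\vdash^{w+v}VW:\mathtt{b}$. ($\oplus$) from $\Gamma\vdash^{w}M:\mathtt{a}$, $\Delta\vdash^{v}N:\mathtt{b}$ infer $\tfrac12\cdot\Gamma\uplus\tfrac12\cdot\Delta\vdash^{\frac12 w+\frac12 v+1}M\oplus N:\tfrac12\mathtt{a}\sqcup\tfrac12\mathtt{b}$. ($\lambda$) from $\Gamma,x:\mathcal{M}\vdash^{w}M:\mathtt{b}$ infer $\Gamma\vdash^{w+1}\lambda x.M:\mathcal{M}\to\mathtt{b}$. (let) from $\Gamma\vdash^{v}N:\langle p_k\mathcal{M}_k\rangle_{k\in K}$ and $\Delta_k,x:\mathcal{M}_k\vdash^{w_k}M:\mathtt{b}_k$ ($k\in K$) infer $\Gamma\uplus_{k}p_k\cdot\Delta_k\vdash^{\sum_k p_kw_k+v+1}\mathtt{let}\ x=N\ \mathtt{in}\ M:\bigsqcup_k p_k\mathtt{b}_k$. (Val) from $\Gamma\vdash^{w}V:\mathcal{M}$ infer $\Gamma\vdash^{w}V:\langle 1\mathcal{M}\rangle$. (!) for finite possibly empty $I$, from $\Gamma_i\vdash^{w_i}V:\mathtt{A}_i$ and scale factors $q_i$ infer $\uplus_i q_i\cdot\Gamma_i\vdash^{\sum_i q_iw_i}V:[q_i\cdot\mathtt{A}_i]_{i\in I}$. A type distribution is tight if all its elements are the empty intersection type, i.e. it has the form $\langle q_k[\,]\rangle_{k\in K}$ ($K$ possibly empty, so $\mathbf{0}$ is tight).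 A derivation of $\vdash^{w}M:\mathtt{a}$ (empty context) is tight if $\mathtt{a}$ is tight. -}

module Defs where

open import Data.Nat using (ℕ; suc)
open import Data.Fin using (Fin)
open import Data.Vec using (Vec; []; _∷_; replicate; zipWith; map; _[_]≔_)
open import Data.List using (List; []; _∷_; _++_; [_])
import Data.List as L
open import Data.List.Relation.Unary.All using (All)
open import Data.Product using (_×_; _,_; Σ; proj₂)
open import Data.Rational using (ℚ; 0ℚ; 1ℚ; ½; _+_; _*_; _<_; _≤_)
open import Relation.Binary.PropositionalEquality using (_≡_)

mutual
  data Val (n : ℕ) : Set where
    var : Fin n → Val n
    lam : Tm (suc n) → Val n          -- λx.M, x bound as index 0

  data Tm (n : ℕ) : Set where
    val  : Val n → Tm n
    app  : Val n → Val n → Tm n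
    _⊕_  : Tm n → Tm n → Tm n
    letin : Tm n → Tm (suc n) → Tm n

-- Types. Multisets are represented as lists (order immaterial for the
-- statement).  Scale factors are rationals.

mutual
  data Arrow : Set where
    _⇒_ : Inter → Dist → Arrow

  -- intersection type [q₁·A₁,…,qₙ·Aₙ]
  Inter : Set
  Inter = List (ℚ × Arrow)

  -- type distribution ⟨p₁M₁,…,pₙMₙ⟩
  Dist : Set
  Dist = List (ℚ × Inter)

𝟎 : Dist
𝟎 = []

scaleI : ℚ → Inter → Inter
scaleI u = L.map (λ { (q , A) → (u * q , A) })

scaleD : ℚ → Dist → Dist
scaleD u = L.map (λ { (p , M) → (u * p , M) })

Ctx : ℕ → Set
Ctx n = Vec Inter n

∅ : ∀ {n} → Ctx n
∅ = replicate _ []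

_⊎C_ : ∀ {n} → Ctx n → Ctx n → Ctx n
_⊎C_ = zipWith _++_

scaleC : ∀ {n} → ℚ → Ctx n → Ctx n
scaleC u = map (scaleI u)

single : ∀ {n} → Fin n → Inter → Ctx n
single x M = ∅ [ x ]≔ M

infix 3 _⊢A⟨_⟩_∶_ _⊢I⟨_⟩_∶_ _⊢D⟨_⟩_∶_

mutual
  data _⊢A⟨_⟩_∶_ {n : ℕ} : Ctx n → ℚ → Val n → Arrow → Set where
    ⊢λ : ∀ {Γ M w t b} →
         (M ∷ Γ) ⊢D⟨ w ⟩ t ∶ b →
         Γ ⊢A⟨ w + 1ℚ ⟩ lam t ∶ (M ⇒ b)

  data _⊢I⟨_⟩_∶_ {n : ℕ} : Ctx n → ℚ → Val n → Inter → Set where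
    ⊢var : ∀ {x M} → single x M ⊢I⟨ 0ℚ ⟩ var x ∶ M
    ⊢!   : ∀ {Γ w V M} → Bang Γ w V M → Γ ⊢I⟨ w ⟩ V ∶ M

  -- premises of rule (!) indexed by a finite list I:
  -- Bang (⊎ᵢ qᵢ·Γᵢ) (Σᵢ qᵢwᵢ) V [qᵢ·Aᵢ]ᵢ
  data Bang {n : ℕ} : Ctx n → ℚ → Val n → Inter → Set where
    []  : ∀ {V} → Bang ∅ 0ℚ V []
    _∷_ : ∀ {Γ Γ' w w' V A M q} →
          (0ℚ < q × q ≤ 1ℚ) × (Γ ⊢A⟨ w ⟩ V ∶ A) →
          Bang Γ' w' V M →
          Bang (scaleC q Γ ⊎C Γ') (q * w + w') V ((q , A) ∷ M)

  data _⊢D⟨_⟩_∶_ {n : ℕ} : Ctx n → ℚ → Tm n → Dist → Set where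
    ⊢zero : ∀ {t} → ∅ ⊢D⟨ 0ℚ ⟩ t ∶ 𝟎
    ⊢val  : ∀ {Γ w V M} → Γ ⊢I⟨ w ⟩ V ∶ M → Γ ⊢D⟨ w ⟩ val V ∶ [ (1ℚ , M) ]
    ⊢app  : ∀ {Γ Δ w v V W M b} →
            Γ ⊢I⟨ w ⟩ V ∶ [ (1ℚ , (M ⇒ b)) ] →
            Δ ⊢I⟨ v ⟩ W ∶ M →
            (Γ ⊎C Δ) ⊢D⟨ w + v ⟩ app V W ∶ b
    ⊢⊕    : ∀ {Γ Δ w v s t a b} →
            Γ ⊢D⟨ w ⟩ s ∶ a → Δ ⊢D⟨ v ⟩ t ∶ b →
            (scaleC ½ Γ ⊎C scaleC ½ Δ) ⊢D⟨ ½ * w + ½ * v + 1ℚ ⟩ s ⊕ t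
              ∶ (scaleD ½ a ++ scaleD ½ b)
    ⊢let  : ∀ {Γ Δ v w N t a b} →
            Γ ⊢D⟨ v ⟩ N ∶ a →
            Branches t a Δ w b →
            (Γ ⊎C Δ) ⊢D⟨ w + v + 1ℚ ⟩ letin N t ∶ b

  -- premises of rule (let), one per element pₖMₖ of the distribution of N:
  -- Branches t ⟨pₖMₖ⟩ₖ (⊎ₖ pₖ·Δₖ) (Σₖ pₖwₖ) (⊔ₖ pₖ·bₖ)
  data Branches {n : ℕ} (t : Tm (suc n)) : Dist → Ctx n → ℚ → Dist → Set where
    []  : Branches t [] ∅ 0ℚ []
    _∷_ : ∀ {p M Δ Δ' w w' b c a} →
          (M ∷ Δ) ⊢D⟨ w ⟩ t ∶ b →
          Branches t a Δ' w' c →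
          Branches t ((p , M) ∷ a) (scaleC p Δ ⊎C Δ') (p * w + w') (scaleD p b ++ c)

Tight : Dist → Set
Tight a = All (λ pM → proj₂ pM ≡ []) a

ClosedDeriv : Tm 0 → Set
ClosedDeriv t = Σ ℚ λ w → Σ Dist λ a → ∅ ⊢D⟨ w ⟩ t ∶ a

bangVal : (V : Val 0) → ∅ ⊢D⟨ 0ℚ ⟩ val V ∶ [ (1ℚ , []) ]
bangVal V = ⊢val (⊢! [])

zeroDer : (V : Val 0) → ∅ ⊢D⟨ 0ℚ ⟩ val V ∶ 𝟎
zeroDer V = ⊢zero

-- A closed value can only be typed by (Zero) or by (Val) over an intersection type; that
-- intersection type comes from (!), since (Var) needs a free variable, and tightness makes
-- it empty, so (!) has no premises and the weight is 0.
module Submission where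

open import Defs
open import Data.List using ([]; [_])
open import Data.Product using (_×_; _,_; proj₁; proj₂)
open import Data.Sum using (_⊎_; inj₁; inj₂)
open import Data.List.Relation.Unary.All using ([]; _∷_)
open import Data.Rational using (0ℚ; 1ℚ)
open import Relation.Binary.PropositionalEquality using (_≡_; _≢_; refl)

bangVal≢zeroDer : (V : Val 0) →
  _≢_ {A = ClosedDeriv (val V)} (0ℚ , [ (1ℚ , []) ] , bangVal V) (0ℚ , 𝟎 , zeroDer V)
bangVal≢zeroDer V ()

tight-closedDeriv-classification : (V : Val 0) (d : ClosedDeriv (val V)) →
  Tight (proj₁ (proj₂ d)) →
  (d ≡ (0ℚ , [ (1ℚ , []) ] , bangVal V)) ⊎ (d ≡ (0ℚ , 𝟎 , zeroDer V))
tight-closedDeriv-classification (var ()) _ _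
tight-closedDeriv-classification (lam t) (_ , _ , ⊢zero)             _            = inj₂ refl
tight-closedDeriv-classification (lam t) (_ , _ , ⊢val (⊢! []))      (refl ∷ []) = inj₁ refl

mainTheorem4 : (V : Val 0) →
    Tight [ (1ℚ , []) ] × Tight 𝟎
    × (_≢_ {A = ClosedDeriv (val V)} (0ℚ , [ (1ℚ , []) ] , bangVal V) (0ℚ , 𝟎 , zeroDer V))
    × ((d : ClosedDeriv (val V)) → Tight (proj₁ (proj₂ d)) →
    (d ≡ (0ℚ , [ (1ℚ , []) ] , bangVal V)) ⊎ (d ≡ (0ℚ , 𝟎 , zeroDer V)))
mainTheorem4 V =
  (refl ∷ []) , [] , bangVal≢zeroDer V , tight-closedDeriv-classification V
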